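{- Let $H$ be a bipartite graph whose diameter $D(H)$ and radius $r(H)$ satisfy $D(H)=r(H)=3$. If $\{a,b\}$ is a local metric basis for $K_1+H$, then $a$ and $b$ belong to different colour classes of $H$.
   Context: All graphs are finite and simple. For a connected graph $X$, $d_X(x,y)$ is the length of a shortest path between $x$ and $y$. A vertex $w$ distinguishes two vertices $x,y$ if $d_X(w,x)\ne d_X(w,y)$. A set $S\subseteq V(X)$ is a local metric generator for $X$ if every two adjacent vertices of $X$ are distinguished by some vertex of $S$; a local metric generator of minimum cardinality is a local metric basis. The join $K_1+H$ is obtained from $H$ by adding one new vertex adjacent to every vertex of $H$. -}

module Defs where

open import Level using (0ℓ)
open import Data.Nat using (ℕ; zero; suc; _<_; _≤_)
open import Data.Fin using (Fin)
import Data.Fin as F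
open import Data.Bool using (Bool)
open import Data.Product using (Σ; ∃; _×_; _,_)
open import Data.Sum using (_⊎_)
open import Data.Unit using (⊤)
open import Data.Empty using (⊥)
open import Data.List using (List; length)
open import Data.List.Membership.Propositional using (_∈_)
open import Data.List.Relation.Unary.Unique.Propositional using (Unique)
open import Relation.Nullary using (¬_)
open import Relation.Binary.PropositionalEquality using (_≡_; _≢_)

record Graph : Set₁ where
  field
    n     : ℕ
    Adj   : Fin n → Fin n → Set
    sym   : ∀ {x y} → Adj x y → Adj y x
    irrefl : ∀ {x} → ¬ Adj x x

open Graph public

V : Graph → Set
V G = Fin (n G)

Reach : (G : Graph) → ℕ → V G → V G → Set
Reach G zero    x y = x ≡ y
Reach G (suc k) x y = Reach G k x y ⊎ Σ (V G) (λ z → Adj G x z × Reach G k z y)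

Dist : (G : Graph) → V G → V G → ℕ → Set
Dist G x y k = Reach G k x y × (∀ j → j < k → ¬ Reach G j x y)

Ecc : (G : Graph) → V G → ℕ → Set
Ecc G v e = (∀ u → Reach G e v u) × Σ (V G) (λ u → Dist G v u e)

Diameter : Graph → ℕ → Set
Diameter G d = (∀ x y → Reach G d x y) × Σ (V G) (λ x → Σ (V G) (λ y → Dist G x y d))

Radius : Graph → ℕ → Set
Radius G r = (∀ v → Σ ℕ (λ e → Ecc G v e × r ≤ e)) × Σ (V G) (λ v → Ecc G v r)

Proper2Colouring : (G : Graph) → (V G → Bool) → Set
Proper2Colouring G c = ∀ x y → Adj G x y → c x ≢ c y

Bipartite : Graph → Set
Bipartite G = Σ (V G → Bool) (Proper2Colouring G)

-- The join K₁ + H: vertex zero is the new apex, suc v is the copy of v ∈ V(H).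
JoinAdj : (H : Graph) → Fin (suc (n H)) → Fin (suc (n H)) → Set
JoinAdj H F.zero    F.zero    = ⊥
JoinAdj H F.zero    (F.suc y) = ⊤
JoinAdj H (F.suc x) F.zero    = ⊤
JoinAdj H (F.suc x) (F.suc y) = Adj H x y

joinSym : (H : Graph) → ∀ {x y} → JoinAdj H x y → JoinAdj H y x
joinSym H {F.zero}  {F.suc y} p = p
joinSym H {F.suc x} {F.zero}  p = p
joinSym H {F.suc x} {F.suc y} p = sym H p

joinIrrefl : (H : Graph) → ∀ {x} → ¬ JoinAdj H x x
joinIrrefl H {F.zero}  ()
joinIrrefl H {F.suc x} p = irrefl H p

K1+ : Graph → Graph
K1+ H = record { n = suc (n H) ; Adj = JoinAdj H ; sym = λ {x} {y} → joinSym H {x} {y} ; irrefl = λ {x} → joinIrrefl H {x} }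

Distinguishes : (G : Graph) → V G → V G → V G → Set
Distinguishes G w x y =
  Σ ℕ (λ k → Σ ℕ (λ l → Dist G w x k × Dist G w y l × k ≢ l))

-- Sets of vertices are represented by duplicate-free lists.
LocalMetricGenerator : (G : Graph) → List (V G) → Set
LocalMetricGenerator G S =
  ∀ x y → Adj G x y → Σ (V G) (λ w → w ∈ S × Distinguishes G w x y)

LocalMetricBasis : (G : Graph) → List (V G) → Set
LocalMetricBasis G S =
  Unique S × LocalMetricGenerator G S ×
  (∀ S' → Unique S' → LocalMetricGenerator G S' → length S ≤ length S')

-- In K₁ + H every two vertices of H are at distance 1 or 2, and the apex is at
-- distance 1 from all of them.  If the apex were in the basis {apex, b}, then, since
-- b has eccentricity 3 in H, the last edge q–u of a path of length 3 leaving b lies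
-- outside the closed neighbourhood of b: both ends are at distance 1 from the apex
-- and 2 from b, so the edge is not distinguished.  Hence a, b ∈ V(H).  If a and b had
-- the same colour, then (as d_H(a, b) ≤ 3) they would be equal or have a common
-- neighbour x, and the edge apex–x is at distance 1 from both a and b.
module Submission where

open import Defs
open import Data.Nat using (ℕ; suc; zero; _<_; _≤_; s≤s; z≤n)
open import Data.Nat.Properties using (<-cmp; m≤n⇒m≤1+n)
open import Data.Nat.GeneralisedArithmetic using (iterate)
import Data.Fin as F
open import Data.Bool using (Bool; not)
open import Data.Bool.Properties using (¬-not; not-¬; not-involutive)
open import Data.Product using (Σ; _×_; _,_; proj₁)
open import Data.Sum using (_⊎_; inj₁; inj₂; [_,_]′)
open import Data.Unit using (tt)
open import Data.Empty using (⊥-elim)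
open import Data.List using (_∷_; [])
open import Data.List.Relation.Unary.Any using (here; there)
open import Data.List.Relation.Unary.All using ([]; _∷_)
open import Data.List.Relation.Unary.AllPairs using (_∷_)
open import Data.List.Relation.Binary.Permutation.Propositional using (_↭_; ↭-refl; ↭-swap)
open import Data.List.Relation.Binary.Permutation.Propositional.Properties using (∈-resp-↭)
open import Function using (_∘_)
open import Relation.Nullary using (¬_)
open import Relation.Binary using (tri<; tri≈; tri>)
open import Relation.Binary.PropositionalEquality using (_≡_; _≢_; refl; trans; cong)
import Relation.Binary.PropositionalEquality as ≡

module _ {G : Graph} where

  data Walk : ℕ → V G → V G → Set where
    []  : ∀ {x} → Walk 0 x x
    _∷_ : ∀ {k x y z} → Adj G x y → Walk k y z → Walk (suc k) x z

  reach⇒walk : ∀ {k x y} → Reach G k x y → Σ ℕ λ j → j ≤ k × Walk j x y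
  reach⇒walk {zero} refl = 0 , z≤n , []
  reach⇒walk {suc k} (inj₁ r) with reach⇒walk r
  ... | j , j≤k , w = j , m≤n⇒m≤1+n j≤k , w
  reach⇒walk {suc k} (inj₂ (z , xz , r)) with reach⇒walk r
  ... | j , j≤k , w = suc j , s≤s j≤k , xz ∷ w

  reach-snoc : ∀ {k x y z} → Reach G k x y → Adj G y z → Reach G (suc k) x z
  reach-snoc {zero} refl yz = inj₂ (_ , yz , refl)
  reach-snoc {suc k} (inj₁ r) yz = inj₁ (reach-snoc r yz)
  reach-snoc {suc k} (inj₂ (w , xw , r)) yz = inj₂ (w , xw , reach-snoc r yz)

  reach-last-edge : ∀ {k x z} → Reach G (suc k) x z → ¬ Reach G k x z →
    Σ (V G) λ y → Reach G k x y × Adj G y z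
  reach-last-edge {zero} (inj₁ r) ¬r = ⊥-elim (¬r r)
  reach-last-edge {zero} (inj₂ (y , xy , refl)) ¬r = _ , refl , xy
  reach-last-edge {suc k} (inj₁ r) ¬r = ⊥-elim (¬r r)
  reach-last-edge {suc k} (inj₂ (w , xw , r)) ¬r
    with reach-last-edge r (λ r′ → ¬r (inj₂ (w , xw , r′)))
  ... | y , wy , yz = y , inj₂ (w , xw , wy) , yz

  far-edge : ∀ {k x z} → ¬ Reach G (suc k) x z → Reach G (suc (suc k)) x z →
    Σ (V G) λ y → Adj G y z × ¬ Reach G k x y
  far-edge ¬r r with reach-last-edge r ¬r
  ... | y , _ , yz = y , yz , λ xy → ¬r (reach-snoc xy yz)

  radius-far : ∀ {r} → Radius G (suc r) → ∀ v → Σ (V G) λ u → ¬ Reach G r v u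
  radius-far {r} (ecc , _) v with ecc v
  ... | _ , (_ , u , _ , minimal) , r<e = u , minimal r r<e

  dist-functional : ∀ {x y k m} → Dist G x y k → Dist G x y m → k ≡ m
  dist-functional {k = k} {m} (rk , mink) (rm , minm) with <-cmp k m
  ... | tri< k<m _ _ = ⊥-elim (minm k k<m rk)
  ... | tri≈ _ k≡m _ = k≡m
  ... | tri> _ _ m<k = ⊥-elim (mink m m<k rm)

  adj⇒dist-one : ∀ {x y} → Adj G x y → Dist G x y 1
  adj⇒dist-one xy = inj₂ (_ , xy , refl) , λ { zero _ refl → irrefl G xy ; (suc _) (s≤s ()) _ }

  equidistant⇒¬distinguishes : ∀ {w x y m} → Dist G w x m → Dist G w y m →
    ¬ Distinguishes G w x y
  equidistant⇒¬distinguishes dx dy (_ , _ , dk , dl , k≢l) =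
    k≢l (trans (dist-functional dk dx) (≡.sym (dist-functional dl dy)))

  undistinguished-edge⇒¬generator : ∀ {a b x y} → Adj G x y →
    ¬ Distinguishes G a x y → ¬ Distinguishes G b x y →
    ¬ LocalMetricGenerator G (a ∷ b ∷ [])
  undistinguished-edge⇒¬generator {x = x} {y} xy ¬a ¬b gen with gen x y xy
  ... | _ , here refl , d = ¬a d
  ... | _ , there (here refl) , d = ¬b d

  generator-resp-↭ : ∀ {S S′} → S ↭ S′ → LocalMetricGenerator G S → LocalMetricGenerator G S′
  generator-resp-↭ S↭S′ gen x y xy with gen x y xy
  ... | w , w∈S , d = w , ∈-resp-↭ S↭S′ w∈S , d

  walk-colour : ∀ {c k x y} → Proper2Colouring G c → Walk k x y → c y ≡ iterate not (c x) k
  walk-colour proper [] = refl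
  walk-colour {c} {suc k} {x} proper (_∷_ {y = y} xy w) =
    trans (walk-colour proper w) (cong (λ b → iterate not b k) cy≡not-cx)
    where
    cy≡not-cx : c y ≡ not (c x)
    cy≡not-cx = ¬-not (proper y x (Graph.sym G xy))

  same-colour-within-three : ∀ {c x y} → Proper2Colouring G c → Reach G 3 x y → c x ≡ c y →
    x ≡ y ⊎ Σ (V G) λ z → Adj G x z × Adj G z y
  same-colour-within-three {c} {x} proper r same with reach⇒walk r
  ... | 0 , _ , [] = inj₁ refl
  ... | 1 , _ , w = ⊥-elim (not-¬ refl (trans same (walk-colour proper w)))
  ... | 2 , _ , xz ∷ (zy ∷ []) = inj₂ (_ , xz , zy)
  ... | 3 , _ , w =
    ⊥-elim (not-¬ refl (trans same (trans (walk-colour proper w) (not-involutive (not (c x))))))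
  ... | suc (suc (suc (suc _))) , s≤s (s≤s (s≤s ())) , _

module _ (H : Graph) where

  join-dist-two : ∀ {x y} → ¬ Reach H 1 x y → Dist (K1+ H) (F.suc x) (F.suc y) 2
  join-dist-two {x} {y} far = inj₂ (F.zero , tt , inj₂ (F.suc y , tt , refl)) , minimal
    where
    minimal : ∀ j → j < 2 → ¬ Reach (K1+ H) j (F.suc x) (F.suc y)
    minimal zero _ refl = far (inj₁ refl)
    minimal (suc zero) _ (inj₁ refl) = far (inj₁ refl)
    minimal (suc zero) _ (inj₂ (F.suc z , xz , refl)) = far (inj₂ (z , xz , refl))
    minimal (suc (suc _)) (s≤s (s≤s ())) _

  apex-pair-¬generator : Diameter H 3 → Radius H 3 → ∀ b →
    ¬ LocalMetricGenerator (K1+ H) (F.zero ∷ F.suc b ∷ [])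
  apex-pair-¬generator (reach , _) rad b with radius-far rad b
  ... | u , ¬b→u with far-edge {G = H} {k = 1} ¬b→u (reach b u)
  ... | q , qu , ¬b→q =
    undistinguished-edge⇒¬generator {G = K1+ H} qu
      (equidistant⇒¬distinguishes (adj⇒dist-one tt) (adj⇒dist-one tt))
      (equidistant⇒¬distinguishes (join-dist-two ¬b→q) (join-dist-two (¬b→u ∘ inj₁)))

  common-neighbour-pair-¬generator : ∀ {a b x} → Adj H a x → Adj H x b →
    ¬ LocalMetricGenerator (K1+ H) (F.suc a ∷ F.suc b ∷ [])
  common-neighbour-pair-¬generator ax xb =
    undistinguished-edge⇒¬generator {G = K1+ H} {x = F.zero} tt
      (equidistant⇒¬distinguishes (adj⇒dist-one tt) (adj⇒dist-one ax))
      (equidistant⇒¬distinguishes (adj⇒dist-one tt) (adj⇒dist-one (Graph.sym H xb)))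

-- Bipartiteness only guarantees that the conclusion is not vacuous.
mainTheorem20 : (H : Graph) → Bipartite H → Diameter H 3 → Radius H 3 →
    (a b : V (K1+ H)) → LocalMetricBasis (K1+ H) (a ∷ b ∷ []) →
    Σ (V H) (λ a' → Σ (V H) (λ b' → a ≡ F.suc a' × b ≡ F.suc b' ×
    (∀ (c : V H → Bool) → Proper2Colouring H c → c a' ≢ c b')))
mainTheorem20 H _ diam rad F.zero F.zero ((zero≢zero ∷ []) ∷ _ , _) = ⊥-elim (zero≢zero refl)
mainTheorem20 H _ diam rad F.zero (F.suc b) (_ , gen , _) =
  ⊥-elim (apex-pair-¬generator H diam rad b gen)
mainTheorem20 H _ diam rad (F.suc a) F.zero (_ , gen , _) =
  ⊥-elim (apex-pair-¬generator H diam rad a (generator-resp-↭ (↭-swap _ _ ↭-refl) gen))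
mainTheorem20 H _ diam rad (F.suc a) (F.suc b) ((sa≢sb ∷ []) ∷ _ , gen , _) =
  a , b , refl , refl , λ c proper same →
    [ sa≢sb ∘ cong F.suc
    , (λ { (_ , ax , xb) → common-neighbour-pair-¬generator H ax xb gen })
    ]′ (same-colour-within-three {G = H} proper (proj₁ diam a b) same)
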